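{- Let $M$ be a proper even set system over $V$. Then $Q_{[a,b,0]}(M)(y)=(-1)^{d_M}Q_{[a,-b,0]}(M)(-y)=(-1)^{d_{M*V}}Q_{[-a,b,0]}(M)(-y)$.
   Context: A set system $M=(V,D)$ is proper if $D\ne\emptyset$ and even if all members of $D$ have cardinalities of the same parity. Twist $M*X=(V,\{Y\triangle X:Y\in D\})$; $d_M=\min\{|Y|:Y\in D\}$. For scalars $a,b$, $Q_{[a,b,0]}(M)(y)=\sum_{B\subseteq V}a^{|V\setminus B|}b^{|B|}y^{d_{M*B}}$ (the specialization $c=0$ of the transition polynomial $\sum_{(A,B,C)}a^{|A|}b^{|B|}c^{|C|}y^{d_{M*B\bar*C}}$ over ordered partitions of $V$ into three possibly empty parts). -}

module Defs where

open import Level using (Level)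
open import Data.Bool using (Bool; _xor_)
open import Data.Nat using (ℕ; zero; suc; _⊓_; _%_)
open import Data.Vec using (Vec; []; _∷_; zipWith)
open import Data.List using (List; []; _∷_; map; foldr; _++_)
open import Data.List.Membership.Propositional using (_∈_)
open import Data.Fin.Subset using (Subset; ∣_∣; ∁; outside; inside)
open import Relation.Binary.PropositionalEquality using (_≡_)
open import Relation.Nullary using (¬_)
open import Algebra.Bundles using (CommutativeRing; Semiring)
import Algebra.Definitions.RawSemiring as RS

-- A set system over V = Fin n: a finite family D of subsets of V,
-- represented as a list (duplicates are harmless for everything below).
SetSystem : ℕ → Set
SetSystem n = List (Subset n)

Proper : ∀ {n} → SetSystem n → Set
Proper D = ¬ (D ≡ [])

Even : ∀ {n} → SetSystem n → Set
Even D = ∀ {Y Z} → Y ∈ D → Z ∈ D → ∣ Y ∣ % 2 ≡ ∣ Z ∣ % 2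

_△_ : ∀ {n} → Subset n → Subset n → Subset n
_△_ = zipWith _xor_

twist : ∀ {n} → SetSystem n → Subset n → SetSystem n
twist D X = map (λ Y → Y △ X) D

-- d_M = min { |Y| : Y ∈ D }  (value on the empty family is irrelevant: 0)
dmin : ∀ {n} → SetSystem n → ℕ
dmin []       = 0
dmin (Y ∷ Ys) = foldr (λ Z m → ∣ Z ∣ ⊓ m) ∣ Y ∣ Ys

allSubsets : ∀ n → List (Subset n)
allSubsets zero    = [] ∷ []
allSubsets (suc n) = map (outside ∷_) (allSubsets n) ++ map (inside ∷_) (allSubsets n)

-- Q_[a,b,0](M)(y) = Σ_{B ⊆ V} a^{|V \ B|} b^{|B|} y^{d_{M*B}}, evaluated in a commutative ring
module _ {c ℓ : Level} (R : CommutativeRing c ℓ) where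
  open CommutativeRing R
  open RS (Semiring.rawSemiring semiring) using (_^_)

  Q₀ : ∀ {n} → SetSystem n → Carrier → Carrier → Carrier → Carrier
  Q₀ {n} D a b y =
    foldr (λ B s → ((a ^ ∣ ∁ B ∣) * (b ^ ∣ B ∣)) * (y ^ dmin (twist D B)) + s) 0#
          (allSubsets n)

  sgn : ℕ → Carrier
  sgn k = (- 1#) ^ k

module Submission where

-- Write d_B = d_{M*B}.  Every member of M*B is Y △ B for some Y ∈ D, and
-- |Y △ B| ≡ |Y| + |B| (mod 2); since D is even and d_B is attained by a
-- member, d_B ≡ d_M + |B| (mod 2).  Consequently, in the monomial
-- a^{|V∖B|} b^{|B|} y^{d_B} of Q, negating b and y produces the sign
-- (-1)^{|B| + d_B} = (-1)^{d_M}, and negating a and y produces the sign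
-- (-1)^{|V∖B| + d_B} = (-1)^{d_M + |V|} = (-1)^{d_{M*V}}.  Since these signs
-- do not depend on B, they factor out of the sum, giving both identities.

open import Defs
open import Level using (Level)
open import Data.Nat using (ℕ; zero; suc; _+_; _⊓_; _%_)
import Data.Nat as Nat
open import Data.Nat.Properties using (+-assoc; +-comm; +-identityʳ; +-suc; *-comm; ⊓-sel; m∸n+n≡m)
open import Data.Nat.DivMod using (%-distribˡ-+; m*n%n≡0)
open import Data.Fin.Subset using (Subset; ⊤; ∣_∣; ∁; inside; outside)
open import Data.Fin.Subset.Properties using (∣⊤∣≡n; ∣p∣≤n; ∣∁p∣≡n∸∣p∣)
open import Data.List using (List; []; _∷_; foldr)
open import Data.List.Relation.Unary.Any using (here; there)
open import Data.List.Membership.Propositional using (_∈_)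
open import Data.List.Membership.Propositional.Properties using (∈-map⁻)
open import Data.Vec using ([]; _∷_)
open import Data.Product using (_×_; _,_; ∃-syntax)
open import Data.Sum using (_⊎_; inj₁; inj₂)
open import Relation.Nullary using (contradiction)
open import Relation.Binary.PropositionalEquality as ≡ using (_≡_; refl)
open import Algebra.Bundles using (CommutativeRing; Semiring)
import Algebra.Definitions.RawSemiring as RawSemiringDefs
import Algebra.Properties.Ring as RingProperties
import Algebra.Properties.Semiring.Exp as ExpProperties
import Algebra.Properties.CommutativeSemiring.Exp as CommExpProperties
import Algebra.Properties.CommutativeSemigroup as CommSemigroupProperties
import Relation.Binary.Reasoning.Setoid as SetoidReasoning

_≡₂_ : ℕ → ℕ → Set
m ≡₂ n = m % 2 ≡ n % 2

infix 4 _≡₂_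

+-congˡ-≡₂ : ∀ m n n′ → n ≡₂ n′ → m + n ≡₂ m + n′
+-congˡ-≡₂ m n n′ n≡₂n′ = begin
  (m + n) % 2                ≡⟨ %-distribˡ-+ m n 2 ⟩
  (m % 2 + n % 2) % 2        ≡⟨ ≡.cong (λ k → (m % 2 + k) % 2) n≡₂n′ ⟩
  (m % 2 + n′ % 2) % 2       ≡⟨ ≡.sym (%-distribˡ-+ m n′ 2) ⟩
  (m + n′) % 2               ∎
  where open ≡.≡-Reasoning

+-congʳ-≡₂ : ∀ m m′ n → m ≡₂ m′ → m + n ≡₂ m′ + n
+-congʳ-≡₂ m m′ n m≡₂m′ =
  ≡.subst₂ _≡₂_ (+-comm n m) (+-comm n m′) (+-congˡ-≡₂ n m m′ m≡₂m′)

m+m≡₂0 : ∀ m → m + m ≡₂ 0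
m+m≡₂0 m = ≡.trans (≡.cong (_% 2) m+m≡m*2) (m*n%n≡0 m 2)
  where
  m+m≡m*2 : m + m ≡ m Nat.* 2
  m+m≡m*2 = ≡.trans (≡.cong (m +_) (≡.sym (+-identityʳ m))) (*-comm 2 m)

-- |Y △ B| ≡ |Y| + |B| (mod 2): elements in both sets are counted twice on the right.
∣△∣≡₂ : ∀ {n} (Y B : Subset n) → ∣ Y △ B ∣ ≡₂ ∣ Y ∣ + ∣ B ∣
∣△∣≡₂ []            []            = refl
∣△∣≡₂ (outside ∷ Y) (outside ∷ B) = ∣△∣≡₂ Y B
∣△∣≡₂ (inside ∷ Y)  (outside ∷ B) = +-congˡ-≡₂ 1 (∣ Y △ B ∣) (∣ Y ∣ + ∣ B ∣) (∣△∣≡₂ Y B)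
∣△∣≡₂ (outside ∷ Y) (inside ∷ B)  =
  ≡.trans (+-congˡ-≡₂ 1 (∣ Y △ B ∣) (∣ Y ∣ + ∣ B ∣) (∣△∣≡₂ Y B)) (≡.cong (_% 2) (≡.sym (+-suc ∣ Y ∣ ∣ B ∣)))
∣△∣≡₂ (inside ∷ Y)  (inside ∷ B)  =
  ≡.trans (∣△∣≡₂ Y B) (≡.cong (λ k → suc k % 2) (≡.sym (+-suc ∣ Y ∣ ∣ B ∣)))

∣∁∣+∣∣≡n : ∀ {n} (B : Subset n) → ∣ ∁ B ∣ + ∣ B ∣ ≡ n
∣∁∣+∣∣≡n B = ≡.trans (≡.cong (_+ ∣ B ∣) (∣∁p∣≡n∸∣p∣ B)) (m∸n+n≡m (∣p∣≤n B))

foldr-⊓-attained : ∀ {n} (x : ℕ) (Zs : List (Subset n)) →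
  let m = foldr (λ Z k → ∣ Z ∣ ⊓ k) x Zs in
  m ≡ x ⊎ ∃[ Z ] Z ∈ Zs × m ≡ ∣ Z ∣
foldr-⊓-attained x []       = inj₁ refl
foldr-⊓-attained x (Z ∷ Zs) with ⊓-sel ∣ Z ∣ (foldr (λ Z k → ∣ Z ∣ ⊓ k) x Zs)
... | inj₁ m≡∣Z∣ = inj₂ (Z , here refl , m≡∣Z∣)
... | inj₂ m≡rest with foldr-⊓-attained x Zs
...   | inj₁ rest≡x              = inj₁ (≡.trans m≡rest rest≡x)
...   | inj₂ (W , W∈Zs , rest≡W) = inj₂ (W , there W∈Zs , ≡.trans m≡rest rest≡W)

dmin-attained : ∀ {n} (D : SetSystem n) → Proper D → ∃[ Z ] Z ∈ D × dmin D ≡ ∣ Z ∣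
dmin-attained []       proper = contradiction refl proper
dmin-attained (Y ∷ Ys) proper with foldr-⊓-attained ∣ Y ∣ Ys
... | inj₁ d≡∣Y∣           = Y , here refl , d≡∣Y∣
... | inj₂ (Z , Z∈Ys , d≡∣Z∣) = Z , there Z∈Ys , d≡∣Z∣

dmin-≡₂ : ∀ {n} {D : SetSystem n} → Proper D → Even D → ∀ {Y} → Y ∈ D → dmin D ≡₂ ∣ Y ∣
dmin-≡₂ {D = D} proper even Y∈D with dmin-attained D proper
... | Z , Z∈D , d≡∣Z∣ = ≡.trans (≡.cong (_% 2) d≡∣Z∣) (even Z∈D Y∈D)

twist-proper : ∀ {n} {D : SetSystem n} (B : Subset n) → Proper D → Proper (twist D B)
twist-proper {D = []}    B proper = contradiction refl proper
twist-proper {D = _ ∷ _} B proper = λ ()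

twist-even : ∀ {n} {D : SetSystem n} (B : Subset n) → Even D → Even (twist D B)
twist-even B even Y′∈ Z′∈ with ∈-map⁻ (_△ B) Y′∈ | ∈-map⁻ (_△ B) Z′∈
... | Y , Y∈D , refl | Z , Z∈D , refl = begin
  ∣ Y △ B ∣ % 2       ≡⟨ ∣△∣≡₂ Y B ⟩
  (∣ Y ∣ + ∣ B ∣) % 2 ≡⟨ +-congʳ-≡₂ (∣ Y ∣) (∣ Z ∣) ∣ B ∣ (even Y∈D Z∈D) ⟩
  (∣ Z ∣ + ∣ B ∣) % 2 ≡⟨ ≡.sym (∣△∣≡₂ Z B) ⟩
  ∣ Z △ B ∣ % 2       ∎
  where open ≡.≡-Reasoning

dmin-twist-≡₂ : ∀ {n} {D : SetSystem n} → Proper D → Even D →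
  ∀ B → dmin (twist D B) ≡₂ dmin D + ∣ B ∣
dmin-twist-≡₂ {D = []}     proper even B = contradiction refl proper
dmin-twist-≡₂ {D = Y ∷ Ys} proper even B = begin
  dmin (twist (Y ∷ Ys) B) % 2  ≡⟨ dmin-≡₂ (twist-proper B proper) (twist-even B even) (here refl) ⟩
  ∣ Y △ B ∣ % 2                ≡⟨ ∣△∣≡₂ Y B ⟩
  (∣ Y ∣ + ∣ B ∣) % 2          ≡⟨ +-congʳ-≡₂ (∣ Y ∣) (dmin (Y ∷ Ys)) ∣ B ∣ (≡.sym (dmin-≡₂ proper even (here refl))) ⟩
  (dmin (Y ∷ Ys) + ∣ B ∣) % 2  ∎
  where open ≡.≡-Reasoning

sign-exponent-by : ∀ {n} {D : SetSystem n} → Proper D → Even D →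
  ∀ B → ∣ B ∣ + dmin (twist D B) ≡₂ dmin D
sign-exponent-by {D = D} proper even B = begin
  (∣ B ∣ + dmin (twist D B)) % 2     ≡⟨ +-congˡ-≡₂ ∣ B ∣ _ _ (dmin-twist-≡₂ proper even B) ⟩
  (∣ B ∣ + (dmin D + ∣ B ∣)) % 2     ≡⟨ ≡.cong (_% 2) (rearrange ∣ B ∣ (dmin D)) ⟩
  (dmin D + (∣ B ∣ + ∣ B ∣)) % 2     ≡⟨ +-congˡ-≡₂ (dmin D) (∣ B ∣ + ∣ B ∣) 0 (m+m≡₂0 ∣ B ∣) ⟩
  (dmin D + 0) % 2                   ≡⟨ ≡.cong (_% 2) (+-identityʳ (dmin D)) ⟩
  dmin D % 2                         ∎
  where
  open ≡.≡-Reasoning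
  rearrange : ∀ b d → b + (d + b) ≡ d + (b + b)
  rearrange b d = ≡.trans (≡.sym (+-assoc b d b))
                    (≡.trans (≡.cong (_+ b) (+-comm b d)) (+-assoc d b b))

sign-exponent-ay : ∀ {n} {D : SetSystem n} → Proper D → Even D →
  ∀ B → ∣ ∁ B ∣ + dmin (twist D B) ≡₂ dmin (twist D ⊤)
sign-exponent-ay {n} {D} proper even B = begin
  (∣ ∁ B ∣ + dmin (twist D B)) % 2     ≡⟨ +-congˡ-≡₂ ∣ ∁ B ∣ _ _ (dmin-twist-≡₂ proper even B) ⟩
  (∣ ∁ B ∣ + (dmin D + ∣ B ∣)) % 2     ≡⟨ ≡.cong (_% 2) (rearrange (∣ ∁ B ∣) (dmin D) ∣ B ∣) ⟩
  (dmin D + (∣ ∁ B ∣ + ∣ B ∣)) % 2     ≡⟨ ≡.cong (λ k → (dmin D + k) % 2) (∣∁∣+∣∣≡n B) ⟩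
  (dmin D + n) % 2                     ≡⟨ ≡.cong (λ k → (dmin D + k) % 2) (≡.sym (∣⊤∣≡n n)) ⟩
  (dmin D + ∣ ⊤ {n} ∣) % 2             ≡⟨ ≡.sym (dmin-twist-≡₂ proper even ⊤) ⟩
  dmin (twist D ⊤) % 2                 ∎
  where
  open ≡.≡-Reasoning
  rearrange : ∀ c d b → c + (d + b) ≡ d + (c + b)
  rearrange c d b = ≡.trans (≡.sym (+-assoc c d b))
                      (≡.trans (≡.cong (_+ b) (+-comm c d)) (+-assoc d c b))

module SignSymmetry {c ℓ : Level} (R : CommutativeRing c ℓ) where
  open CommutativeRing R renaming (refl to ≈-refl; _+_ to _+ᴿ_)
  open RawSemiringDefs (Semiring.rawSemiring semiring) using (_^_)
  open RingProperties ring using (-1*x≈-x; -‿involutive)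
  open ExpProperties semiring using (^-homo-*; ^-congˡ)
  open CommExpProperties commutativeSemiring using (^-distrib-*)
  open CommSemigroupProperties *-commutativeSemigroup using (interchange)
  open SetoidReasoning setoid

  s : ℕ → Carrier
  s = sgn R

  sgn-suc-suc : ∀ k → s (suc (suc k)) ≈ s k
  sgn-suc-suc k = begin
    - 1# * (- 1# * s k)  ≈⟨ *-congˡ (-1*x≈-x (s k)) ⟩
    - 1# * - s k         ≈⟨ -1*x≈-x (- s k) ⟩
    - - s k              ≈⟨ -‿involutive (s k) ⟩
    s k                  ∎

  sgn-mod2 : ∀ k → s k ≈ s (k % 2)
  sgn-mod2 zero          = ≈-refl
  sgn-mod2 (suc zero)    = ≈-refl
  sgn-mod2 (suc (suc k)) = trans (sgn-suc-suc k) (sgn-mod2 k)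

  sgn-≡₂ : ∀ m n → m ≡₂ n → s m ≈ s n
  sgn-≡₂ m n m≡₂n = trans (sgn-mod2 m) (trans (reflexive (≡.cong s m≡₂n)) (sym (sgn-mod2 n)))

  sgn-cancel : ∀ k x → s k * (s k * x) ≈ x
  sgn-cancel k x = begin
    s k * (s k * x)  ≈⟨ sym (*-assoc (s k) (s k) x) ⟩
    s k * s k * x    ≈⟨ *-congʳ (sym (^-homo-* (- 1#) k k)) ⟩
    s (k Nat.+ k) * x    ≈⟨ *-congʳ (sgn-≡₂ (k Nat.+ k) 0 (m+m≡₂0 k)) ⟩
    1# * x           ≈⟨ *-identityˡ x ⟩
    x                ∎

  sign-flip : ∀ k {x x′} → x′ ≈ s k * x → x ≈ s k * x′
  sign-flip k {x} {x′} x′≈ = sym (trans (*-congˡ x′≈) (sgn-cancel k x))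

  neg-^ : ∀ x k → (- x) ^ k ≈ s k * x ^ k
  neg-^ x k = trans (^-congˡ k (sym (-1*x≈-x x))) (^-distrib-* (- 1#) x k)

  collect-signs : ∀ p q r u v w →
    ((s p * u) * (s q * v)) * (s r * w) ≈ s (p Nat.+ (q Nat.+ r)) * ((u * v) * w)
  collect-signs p q r u v w = begin
    ((s p * u) * (s q * v)) * (s r * w)  ≈⟨ *-congʳ (interchange (s p) u (s q) v) ⟩
    ((s p * s q) * (u * v)) * (s r * w)  ≈⟨ interchange (s p * s q) (u * v) (s r) w ⟩
    ((s p * s q) * s r) * ((u * v) * w)  ≈⟨ *-congʳ (*-assoc (s p) (s q) (s r)) ⟩
    (s p * (s q * s r)) * ((u * v) * w)  ≈⟨ *-congʳ (*-congˡ (sym (^-homo-* (- 1#) q r))) ⟩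
    (s p * s (q Nat.+ r)) * ((u * v) * w)    ≈⟨ *-congʳ (sym (^-homo-* (- 1#) p (q Nat.+ r))) ⟩
    s (p Nat.+ (q Nat.+ r)) * ((u * v) * w)      ∎

  foldr-scale : ∀ {A : Set} (σ : Carrier) (f g : A → Carrier) → (∀ x → f x ≈ σ * g x) →
    ∀ xs → foldr (λ x acc → f x +ᴿ acc) 0# xs ≈ σ * foldr (λ x acc → g x +ᴿ acc) 0# xs
  foldr-scale σ f g f≈σg []       = sym (zeroʳ σ)
  foldr-scale σ f g f≈σg (x ∷ xs) =
    trans (+-cong (f≈σg x) (foldr-scale σ f g f≈σg xs)) (sym (distribˡ σ (g x) _))

  module _ {n : ℕ} (D : SetSystem n) where

    monomial : Carrier → Carrier → Carrier → Subset n → Carrier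
    monomial a b y B = ((a ^ ∣ ∁ B ∣) * (b ^ ∣ B ∣)) * (y ^ dmin (twist D B))

    Q₀-scale : ∀ σ {a b y a′ b′ y′} → (∀ B → monomial a b y B ≈ σ * monomial a′ b′ y′ B) →
      Q₀ R D a b y ≈ σ * Q₀ R D a′ b′ y′
    Q₀-scale σ {a} {b} {y} {a′} {b′} {y′} termwise =
      foldr-scale σ (monomial a b y) (monomial a′ b′ y′) termwise (allSubsets n)

    monomial-neg-by : ∀ a b y B →
      monomial a (- b) (- y) B ≈ s (∣ B ∣ Nat.+ dmin (twist D B)) * monomial a b y B
    monomial-neg-by a b y B = begin
      monomial a (- b) (- y) B
        ≈⟨ *-cong (*-cong (sym (*-identityˡ _)) (neg-^ b ∣ B ∣)) (neg-^ y (dmin (twist D B))) ⟩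
      ((s 0 * a ^ ∣ ∁ B ∣) * (s ∣ B ∣ * b ^ ∣ B ∣)) * (s (dmin (twist D B)) * y ^ dmin (twist D B))
        ≈⟨ collect-signs 0 ∣ B ∣ (dmin (twist D B)) _ _ _ ⟩
      s (∣ B ∣ Nat.+ dmin (twist D B)) * monomial a b y B ∎

    monomial-neg-ay : ∀ a b y B →
      monomial (- a) b (- y) B ≈ s (∣ ∁ B ∣ Nat.+ dmin (twist D B)) * monomial a b y B
    monomial-neg-ay a b y B = begin
      monomial (- a) b (- y) B
        ≈⟨ *-cong (*-cong (neg-^ a ∣ ∁ B ∣) (sym (*-identityˡ _))) (neg-^ y (dmin (twist D B))) ⟩
      ((s ∣ ∁ B ∣ * a ^ ∣ ∁ B ∣) * (s 0 * b ^ ∣ B ∣)) * (s (dmin (twist D B)) * y ^ dmin (twist D B))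
        ≈⟨ collect-signs ∣ ∁ B ∣ 0 (dmin (twist D B)) _ _ _ ⟩
      s (∣ ∁ B ∣ Nat.+ dmin (twist D B)) * monomial a b y B ∎

    monomial-negate-b-y : Proper D → Even D → ∀ a b y B →
      monomial a (- b) (- y) B ≈ s (dmin D) * monomial a b y B
    monomial-negate-b-y proper even a b y B =
      trans (monomial-neg-by a b y B)
            (*-congʳ (sgn-≡₂ (∣ B ∣ Nat.+ dmin (twist D B)) (dmin D) (sign-exponent-by proper even B)))

    monomial-negate-a-y : Proper D → Even D → ∀ a b y B →
      monomial (- a) b (- y) B ≈ s (dmin (twist D ⊤)) * monomial a b y B
    monomial-negate-a-y proper even a b y B =
      trans (monomial-neg-ay a b y B)
            (*-congʳ (sgn-≡₂ (∣ ∁ B ∣ Nat.+ dmin (twist D B)) (dmin (twist D ⊤)) (sign-exponent-ay proper even B)))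

    Q₀-negate-b-y : Proper D → Even D → ∀ a b y →
      Q₀ R D a b y ≈ s (dmin D) * Q₀ R D a (- b) (- y)
    Q₀-negate-b-y proper even a b y =
      Q₀-scale (s (dmin D)) λ B → sign-flip (dmin D) (monomial-negate-b-y proper even a b y B)

    Q₀-negate-a-y : Proper D → Even D → ∀ a b y →
      Q₀ R D a b y ≈ s (dmin (twist D ⊤)) * Q₀ R D (- a) b (- y)
    Q₀-negate-a-y proper even a b y =
      Q₀-scale (s (dmin (twist D ⊤))) λ B → sign-flip (dmin (twist D ⊤)) (monomial-negate-a-y proper even a b y B)

lemma5 : {c ℓ : Level} (R : CommutativeRing c ℓ) (n : ℕ) (D : SetSystem n) →
    Proper D → Even D →
    let open CommutativeRing R in
    (a b y : Carrier) →
      (Q₀ R D a b y ≈ sgn R (dmin D) * Q₀ R D a (- b) (- y))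
      × (Q₀ R D a b y ≈ sgn R (dmin (twist D ⊤)) * Q₀ R D (- a) b (- y))
lemma5 R n D proper even a b y =
  Q₀-negate-b-y D proper even a b y , Q₀-negate-a-y D proper even a b y
  where open SignSymmetry R
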